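{- Let $\Sigma$ be a finite alphabet with $0\in\Sigma$, let $A\notin\Sigma$, let $\alpha=A.0.A.0^2.A.0^3.A\cdots A.0^n.A.0^{n+1}.A\cdots\in(\Sigma\cup\{A\})^\omega$, and let $h:\Sigma^\omega\to(\Sigma\cup\{A\})^\omega$ be given by $h(x)=A.0.x(1).A.0^2.x(2).A.0^3.x(3).A\cdots A.0^n.x(n).A\cdots$. Then the set $$R_2=(\Sigma\cup\{A\})^\omega\times(\Sigma\cup\{A\})^\omega\setminus\big(h(\Sigma^\omega)\times\{\alpha\}\big)$$ is an infinitary rational relation.
   Context: $x(i)$ is the $i$-th letter of $x$; $0^n$ is $n$ copies of $0$. A 2-tape Büchi automaton is $\mathcal{T}=(K,\Sigma_1,\Sigma_2,\Delta,q_0,F)$ with $K$ a finite set of states, $\Sigma_1,\Sigma_2$ finite alphabets, $\Delta$ a finite subset of $K\times\Sigma_1^\star\times\Sigma_2^\star\times K$, $q_0\in K$, $F\subseteq K$. A computation is an infinite sequence of transitions $(q_0,u_1,v_1,q_1),(q_1,u_2,v_2,q_2),\ldots$ in $\Delta$, successful if some state of $F$ occurs as $q_i$ for infinitely many $i$, with input word $u_1u_2\cdots$ and output word $v_1v_2\cdots$. The relation accepted is the set of pairs $(u,v)\in\Sigma_1^\omega\times\Sigma_2^\omega$ that are input and output of some successful computation; such relations are called infinitary rational relations. -}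

module Defs where

open import Data.Nat using (ℕ; zero; suc; _≤_; _<_)
open import Data.Fin using (Fin)
open import Data.Fin.Subset using (Subset; _∈_)
open import Data.List using (List; []; _∷_; _++_; length; replicate; [_])
open import Data.List.Membership.Propositional renaming (_∈_ to _∈ₗ_)
open import Data.Maybe using (Maybe; just; nothing)
open import Data.Product using (Σ; ∃; _×_; _,_; proj₁; proj₂)
open import Data.Unit using (⊤)
open import Relation.Binary.PropositionalEquality using (_≡_)
open import Relation.Nullary using (¬_)
open import Function.Bundles using (_⇔_)

-- ω-words over an alphabet S (positions indexed from 0)
Word : Set → Set
Word S = ℕ → S

Prefix : {S : Set} → List S → Word S → Set
Prefix [] w = ⊤
Prefix (a ∷ u) w = (a ≡ w 0) × Prefix u (λ i → w (suc i))

concatUpTo : {S : Set} → (ℕ → List S) → ℕ → List S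
concatUpTo b zero = []
concatUpTo b (suc n) = concatUpTo b n ++ b n

-- the infinite concatenation b 0 · b 1 · b 2 ⋯ is an ω-word and equals w
IsConcat : {S : Set} → (ℕ → List S) → Word S → Set
IsConcat b w = (∀ n → Prefix (concatUpTo b n) w)
             × (∀ j → ∃ λ n → j < length (concatUpTo b n))

record TwoTapeBuchi (Σ₁ Σ₂ : Set) : Set where
  field
    nStates : ℕ
    Δ       : List (Fin nStates × List Σ₁ × List Σ₂ × Fin nStates)
    q₀      : Fin nStates
    F       : Subset nStates

module _ {Σ₁ Σ₂ : Set} (T : TwoTapeBuchi Σ₁ Σ₂) where
  open TwoTapeBuchi T

  Transition : Set
  Transition = Fin nStates × List Σ₁ × List Σ₂ × Fin nStates

  src : Transition → Fin nStates
  src (p , _ , _ , _) = p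

  tgt : Transition → Fin nStates
  tgt (_ , _ , _ , q) = q

  inLbl : Transition → List Σ₁
  inLbl (_ , u , _ , _) = u

  outLbl : Transition → List Σ₂
  outLbl (_ , _ , v , _) = v

  -- t i is the (i+1)-th transition (q_i, u_{i+1}, v_{i+1}, q_{i+1})
  IsComputation : (ℕ → Transition) → Set
  IsComputation t = (∀ i → t i ∈ₗ Δ)
                  × (src (t 0) ≡ q₀)
                  × (∀ i → tgt (t i) ≡ src (t (suc i)))

  IsSuccessful : (ℕ → Transition) → Set
  IsSuccessful t = ∀ N → ∃ λ i → N ≤ i × tgt (t i) ∈ F

  Accepts : Word Σ₁ → Word Σ₂ → Set
  Accepts u v = ∃ λ t → IsComputation t × IsSuccessful t
                      × IsConcat (λ i → inLbl (t i)) u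
                      × IsConcat (λ i → outLbl (t i)) v

IsInfinitaryRational : {Σ₁ Σ₂ : Set} → (Word Σ₁ → Word Σ₂ → Set) → Set
IsInfinitaryRational {Σ₁} {Σ₂} R =
  Σ (TwoTapeBuchi Σ₁ Σ₂) λ T → ∀ u v → (Accepts T u v ⇔ R u v)

-- Σ = Fin (suc k) with letter 0 = Fin.zero; Σ ∪ {A} = Maybe Σ with A = nothing
Ext : ℕ → Set
Ext k = Maybe (Fin (suc k))

αBlock : (k : ℕ) → ℕ → List (Ext k)
αBlock k n = nothing ∷ replicate (suc n) (just Fin.zero)

-- block n of h(x):  A . 0^(n+1) . x(n+1)   (paper's x(n+1) is x n here)
hBlock : (k : ℕ) → Word (Fin (suc k)) → ℕ → List (Ext k)
hBlock k x n = nothing ∷ (replicate (suc n) (just Fin.zero) ++ [ just (x n) ])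

InHα : (k : ℕ) → Word (Ext k) → Word (Ext k) → Set
InHα k x y = (∃ λ z → IsConcat (hBlock k z) x) × IsConcat (αBlock k) y

R₂ : (k : ℕ) → Word (Ext k) → Word (Ext k) → Set
R₂ k x y = ¬ InHα k x y

module Submission where

-- Write hPos n and αPos n for the positions at which block n of h(z)
-- (A 0^(n+1) σ, length n+3) and of α (A 0^(n+1), length n+2) start.  A pair
-- (x , y) lies in h(Σ^ω) × {α} iff every block of x and of y has the right
-- shape at these positions.  The automaton guesses the first defect and jumps
-- to an accepting sink that copies the rest of both tapes.  To find it, it
-- reads both tapes in lockstep along one of two alignments: either block n of
-- x against block n of y (the zero runs must have equal length, x's letter
-- meets y's next A), or block n of x against block n+1 of y (both have length
-- n+3).  Each local mismatch is an error transition into the sink.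

open import Defs
open import Level using (0ℓ)
open import Axiom.ExcludedMiddle using (ExcludedMiddle)
open import Data.Nat using (ℕ; zero; suc; _+_; _≤_; _<_; z≤n; s≤s)
open import Data.Nat.Properties
  using (+-identityʳ; +-comm; +-assoc; +-suc; +-mono-≤; ≤-refl; ≤-trans; ≤-pred; <⇒≤;
         m≤n⇒m≤1+n; m≤n+m; m<1+n⇒m<n∨m≡n; m≤n⇒m<n∨m≡n)
open import Data.Fin using (Fin; zero; suc)
open import Data.Fin.Subset using (⁅_⁆; _∈_)
open import Data.Fin.Subset.Properties using (x∈⁅x⁆; x∈⁅y⁆⇒x≡y)
open import Data.List using (List; []; _∷_; _++_; length; replicate; [_]; map; concatMap; allFin;
                             cartesianProductWith)
open import Data.List.Properties using (length-++; length-replicate; ++-identityʳ; ++-assoc)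
open import Data.List.Relation.Unary.Any using (here; there)
open import Data.List.Membership.Propositional using (lose) renaming (_∈_ to _∈ₗ_)
open import Data.List.Membership.Propositional.Properties
  using (∈-map⁺; ∈-map⁻; ∈-++⁺ˡ; ∈-++⁺ʳ; ∈-concatMap⁺; ∈-allFin; ∈-cartesianProductWith⁺)
open import Data.Maybe using (just; nothing)
open import Data.Product using (∃; _×_; _,_; proj₁; proj₂)
open import Data.Sum using (_⊎_; inj₁; inj₂; [_,_]′)
open import Data.Unit using (tt)
open import Data.Empty using (⊥; ⊥-elim)
open import Function using (id; _∘_)
open import Function.Bundles using (mk⇔)
open import Relation.Nullary using (¬_; yes; no)
open import Relation.Binary.PropositionalEquality
  using (_≡_; refl; sym; trans; cong; cong₂; subst; subst₂; module ≡-Reasoning)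

-- (1) Prefixes and infinite concatenations of ω-words

-- The ω-word w with its first l letters removed; positions are written
-- offset-first, so that the head of suffix P w is w P on the nose.
suffix : {S : Set} → ℕ → Word S → Word S
suffix l w i = w (i + l)

Prefix-resp : {S : Set} (u : List S) {w w′ : Word S} → (∀ i → w i ≡ w′ i) → Prefix u w → Prefix u w′
Prefix-resp []      eq _       = tt
Prefix-resp (a ∷ u) eq (p , q) = trans p (eq 0) , Prefix-resp u (eq ∘ suc) q

suffix-zero : {S : Set} (w : Word S) (i : ℕ) → suffix 0 w i ≡ w i
suffix-zero w i = cong w (+-identityʳ i)

suffix-suc : {S : Set} (l : ℕ) (w : Word S) (i : ℕ) → suffix (suc l) w i ≡ suffix l (w ∘ suc) i
suffix-suc l w i = cong w (+-suc i l)

prefix-++ : {S : Set} (u : List S) {v : List S} {w : Word S} →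
            Prefix u w → Prefix v (suffix (length u) w) → Prefix (u ++ v) w
prefix-++ []      {v} {w} _ q = Prefix-resp v (suffix-zero w) q
prefix-++ (a ∷ u) {v} {w} (p , p′) q = p , prefix-++ u p′ (Prefix-resp v (suffix-suc (length u) w) q)

prefix-++⁻ : {S : Set} (u : List S) {v : List S} {w : Word S} →
             Prefix (u ++ v) w → Prefix v (suffix (length u) w)
prefix-++⁻ []      {v} {w} p = Prefix-resp v (sym ∘ suffix-zero w) p
prefix-++⁻ (a ∷ u) {v} {w} (_ , p′) = Prefix-resp v (λ i → sym (suffix-suc (length u) w i)) (prefix-++⁻ u p′)

suffix-+ : {S : Set} (l P : ℕ) (w : Word S) (i : ℕ) → suffix (l + P) w i ≡ suffix l (suffix P w) i
suffix-+ l P w i = cong w (sym (+-assoc i l P))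

written : {S : Set} {w : Word S} {P : ℕ} {a : S} → w P ≡ a → Prefix [ a ] (suffix P w)
written e = sym e , tt

read : {S : Set} {w : Word S} {P : ℕ} {a : S} → Prefix [ a ] (suffix P w) → w P ≡ a
read (e , _) = sym e

prefix-replicate⁻ : {S : Set} (m : ℕ) {a : S} {rest : List S} {w : Word S} →
                    Prefix (replicate m a ++ rest) w →
                    (∀ r → r < m → w r ≡ a) × Prefix rest (suffix m w)
prefix-replicate⁻ zero    {rest = rest} {w} p = (λ _ ()) , Prefix-resp rest (sym ∘ suffix-zero w) p
prefix-replicate⁻ (suc m) {rest = rest} {w} (e , p) with prefix-replicate⁻ m p
... | run , tail = (λ { zero _ → sym e ; (suc r) (s≤s r<m) → run r r<m })
                 , Prefix-resp rest (sym ∘ suffix-suc m w) tail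

prefix-replicate⁺ : {S : Set} (m : ℕ) {a : S} {rest : List S} {w : Word S} →
                    (∀ r → r < m → w r ≡ a) → Prefix rest (suffix m w) →
                    Prefix (replicate m a ++ rest) w
prefix-replicate⁺ zero    {rest = rest} {w} _   p = Prefix-resp rest (suffix-zero w) p
prefix-replicate⁺ (suc m) {rest = rest} {w} run p =
  sym (run 0 (s≤s z≤n)) ,
  prefix-replicate⁺ m (λ r r<m → run (suc r) (s≤s r<m)) (Prefix-resp rest (suffix-suc m w) p)

concatUpTo-suc : {S : Set} (b : ℕ → List S) (n : ℕ) →
                 concatUpTo b (suc n) ≡ b 0 ++ concatUpTo (b ∘ suc) n
concatUpTo-suc b zero    = sym (++-identityʳ (b 0))
concatUpTo-suc b (suc n) = trans (cong (_++ b (suc n)) (concatUpTo-suc b n)) (++-assoc (b 0) _ (b (suc n)))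

length-concatUpTo-suc : {S : Set} (b : ℕ → List S) (n : ℕ) →
                        length (concatUpTo b (suc n)) ≡ length (b n) + length (concatUpTo b n)
length-concatUpTo-suc b n = trans (length-++ (concatUpTo b n)) (+-comm (length (concatUpTo b n)) (length (b n)))

isConcat-block : {S : Set} (b : ℕ → List S) {w : Word S} → IsConcat b w →
                 ∀ n → Prefix (b n) (suffix (length (concatUpTo b n)) w)
isConcat-block b (prefixes , _) n = prefix-++⁻ (concatUpTo b n) (prefixes (suc n))

blocks⇒isConcat : {S : Set} (b : ℕ → List S) {w : Word S} → (∀ n → 0 < length (b n)) →
                  (∀ n → Prefix (b n) (suffix (length (concatUpTo b n)) w)) → IsConcat b w
blocks⇒isConcat b {w} nonempty blocks = prefixes , λ j → suc j , grows (suc j)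
  where
  prefixes : ∀ n → Prefix (concatUpTo b n) w
  prefixes zero    = tt
  prefixes (suc n) = prefix-++ (concatUpTo b n) (prefixes n) (blocks n)
  grows : ∀ n → n ≤ length (concatUpTo b n)
  grows zero    = z≤n
  grows (suc n) = subst (suc n ≤_) (sym (length-concatUpTo-suc b n)) (+-mono-≤ (nonempty n) (grows n))

isConcat-cons : {S : Set} (b : ℕ → List S) {w : Word S} → Prefix (b 0) w →
                IsConcat (b ∘ suc) (suffix (length (b 0)) w) → IsConcat b w
isConcat-cons b {w} p (prefixes , unbounded) = prefixes′ , unbounded′
  where
  prefixes′ : ∀ n → Prefix (concatUpTo b n) w
  prefixes′ zero    = tt
  prefixes′ (suc n) = subst (λ l → Prefix l w) (sym (concatUpTo-suc b n)) (prefix-++ (b 0) p (prefixes n))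
  unbounded′ : ∀ j → ∃ λ n → j < length (concatUpTo b n)
  unbounded′ j with unbounded j
  ... | m , j<ℓ = suc m , subst (j <_) (sym (trans (cong length (concatUpTo-suc b m)) (length-++ (b 0))))
                                (≤-trans j<ℓ (m≤n+m _ (length (b 0))))

isConcat-letters : {S : Set} (w : Word S) → IsConcat (λ i → [ w i ]) w
isConcat-letters w = blocks⇒isConcat (λ i → [ w i ]) (λ _ → s≤s z≤n)
  (λ n → written {w = w} (cong w (length-letters n)))
  where
  length-letters : ∀ n → length (concatUpTo (λ i → [ w i ]) n) ≡ n
  length-letters zero    = refl
  length-letters (suc n) = trans (length-concatUpTo-suc (λ i → [ w i ]) n) (cong suc (length-letters n))

-- A 2-tape Büchi automaton rejects (u , v) as soon as some property of
-- (state, input position, output position) holds initially, is preserved by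
-- every transition whose labels are read at those positions, and fails at
-- accepting states: no run can then pass through an accepting state at all.
invariant⇒rejects : {Σ₁ Σ₂ : Set} (T : TwoTapeBuchi Σ₁ Σ₂) (u : Word Σ₁) (v : Word Σ₂) →
  let open TwoTapeBuchi T in
  (I : Fin nStates → ℕ → ℕ → Set) → I q₀ 0 0 →
  (∀ {P Q} t → t ∈ₗ Δ → I (src T t) P Q →
     Prefix (inLbl T t) (suffix P u) → Prefix (outLbl T t) (suffix Q v) →
     I (tgt T t) (length (inLbl T t) + P) (length (outLbl T t) + Q)) →
  (∀ {q P Q} → q ∈ F → ¬ I q P Q) → ¬ Accepts T u v
invariant⇒rejects T u v I initially preserved rejecting
                  (t , (t∈Δ , t₀ , linked) , success , inU , inV) with success 0
... | i , _ , tᵢ∈F = rejecting tᵢ∈F (afterStep i (beforeStep i))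
  where
  ins outs : ℕ → List _
  ins  = λ j → inLbl T (t j)
  outs = λ j → outLbl T (t j)
  inPos outPos : ℕ → ℕ
  inPos  j = length (concatUpTo ins j)
  outPos j = length (concatUpTo outs j)
  afterStep : ∀ j → I (src T (t j)) (inPos j) (outPos j) → I (tgt T (t j)) (inPos (suc j)) (outPos (suc j))
  afterStep j holds = subst₂ (I (tgt T (t j))) (sym (length-concatUpTo-suc ins j)) (sym (length-concatUpTo-suc outs j))
    (preserved (t j) (t∈Δ j) holds (isConcat-block ins inU j) (isConcat-block outs inV j))
  beforeStep : ∀ j → I (src T (t j)) (inPos j) (outPos j)
  beforeStep zero    = subst (λ q → I q 0 0) (sym t₀) initially
  beforeStep (suc j) = subst (λ q → I q (inPos (suc j)) (outPos (suc j))) (linked j)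
                             (afterStep j (beforeStep j))

moveTo : {S : Set} (u : List S) {w : Word S} {P P′ : ℕ} →
         P ≡ P′ → Prefix u (suffix P w) → Prefix u (suffix P′ w)
moveTo u refl p = p

extendBelow : {P : ℕ → Set} {n : ℕ} → (∀ i → i < n → P i) → P n → ∀ i → i < suc n → P i
extendBelow below atN i i<1+n with m<1+n⇒m<n∨m≡n i<1+n
... | inj₁ i<n  = below i i<n
... | inj₂ refl = atN

-- (2) Blocks of h(Σ^ω) and of α

-- Block n of h(z) has length n+3, block n of α has length n+2.
hPos αPos : ℕ → ℕ
hPos zero    = 0
hPos (suc n) = 3 + n + hPos n
αPos zero    = 0
αPos (suc n) = 2 + n + αPos n

pattern A = nothing
pattern 𝟎 = just zero

module Blocks (k : ℕ) where

  length-hBlock : ∀ z n → length (hBlock k z n) ≡ 3 + n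
  length-hBlock z n = cong suc (begin
    length (replicate (suc n) 𝟎 ++ [ just (z n) ])  ≡⟨ length-++ (replicate (suc n) 𝟎) ⟩
    length (replicate (suc n) 𝟎) + 1                ≡⟨ cong (_+ 1) (length-replicate (suc n)) ⟩
    suc n + 1                                       ≡⟨ +-comm (suc n) 1 ⟩
    2 + n                                           ∎)
    where open ≡-Reasoning

  length-hUpTo : ∀ z n → length (concatUpTo (hBlock k z) n) ≡ hPos n
  length-hUpTo z zero    = refl
  length-hUpTo z (suc n) =
    trans (length-concatUpTo-suc (hBlock k z) n) (cong₂ _+_ (length-hBlock z n) (length-hUpTo z n))

  length-αUpTo : ∀ n → length (concatUpTo (αBlock k) n) ≡ αPos n
  length-αUpTo zero    = refl
  length-αUpTo (suc n) =
    trans (length-concatUpTo-suc (αBlock k) n) (cong₂ _+_ (cong suc (length-replicate (suc n))) (length-αUpTo n))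

  record HShaped (x : Word (Ext k)) (n : ℕ) : Set where
    field
      marker   : x (hPos n) ≡ A
      zeros    : ∀ r → r ≤ n → x (suc r + hPos n) ≡ 𝟎
      letter   : Fin (suc k)
      letterAt : x (suc (suc n) + hPos n) ≡ just letter

    inΣ : ∀ r → r ≤ suc n → ∃ λ σ → x (suc r + hPos n) ≡ just σ
    inΣ r r≤1+n with m≤n⇒m<n∨m≡n r≤1+n
    ... | inj₁ r<1+n = zero , zeros r (≤-pred r<1+n)
    ... | inj₂ refl  = letter , letterAt

  record αShaped (y : Word (Ext k)) (n : ℕ) : Set where
    field
      marker : y (αPos n) ≡ A
      zeros  : ∀ r → r ≤ n → y (suc r + αPos n) ≡ 𝟎

  hBlock⇒shaped : ∀ {x} z n → Prefix (hBlock k z n) (suffix (hPos n) x) → HShaped x n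
  hBlock⇒shaped {x} z n (isA , body) with prefix-replicate⁻ (suc n) body
  ... | run , last = record { marker = sym isA ; zeros = λ r r≤n → run r (s≤s r≤n)
                            ; letter = z n ; letterAt = read {w = λ i → x (suc i + hPos n)} last }

  shaped⇒hBlock : ∀ {x n} (s : HShaped x n) →
                  Prefix (hBlock k (λ _ → HShaped.letter s) n) (suffix (hPos n) x)
  shaped⇒hBlock {x} {n} s =
    (sym marker , prefix-replicate⁺ (suc n) (λ r r<1+n → zeros r (≤-pred r<1+n))
                                    (written {w = λ i → x (suc i + hPos n)} letterAt))
    where open HShaped s

  αBlock⇒shaped : ∀ {y} n → Prefix (αBlock k n) (suffix (αPos n) y) → αShaped y n
  αBlock⇒shaped {y} n (isA , body) = record { marker = sym isA ; zeros = λ r r≤n → run r (s≤s r≤n) }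
    where
    run : ∀ r → r < suc n → y (suc r + αPos n) ≡ 𝟎
    run = proj₁ (prefix-replicate⁻ (suc n) {rest = []}
            (subst (λ l → Prefix l (λ i → y (suc i + αPos n))) (sym (++-identityʳ _)) body))

  shaped⇒αBlock : ∀ {y n} → αShaped y n → Prefix (αBlock k n) (suffix (αPos n) y)
  shaped⇒αBlock {y} {n} s =
    (sym marker , subst (λ l → Prefix l (λ i → y (suc i + αPos n))) (++-identityʳ _)
                        (prefix-replicate⁺ (suc n) (λ r r<1+n → zeros r (≤-pred r<1+n)) tt))
    where open αShaped s

  InHα⇒shaped : ∀ {x y} → InHα k x y → (∀ n → HShaped x n) × (∀ n → αShaped y n)
  InHα⇒shaped {x} {y} ((z , xh) , yα) =
    (λ n → hBlock⇒shaped z n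
             (moveTo (hBlock k z n) {x} (length-hUpTo z n) (isConcat-block (hBlock k z) xh n))) ,
    (λ n → αBlock⇒shaped n (moveTo (αBlock k n) {y} (length-αUpTo n) (isConcat-block (αBlock k) yα n)))

  shaped⇒InHα : ∀ {x y} → (∀ n → HShaped x n) → (∀ n → αShaped y n) → InHα k x y
  shaped⇒InHα {x} {y} xs ys =
    (z , blocks⇒isConcat (hBlock k z) (λ _ → s≤s z≤n)
           (λ n → moveTo (hBlock k z n) {x} (sym (length-hUpTo z n)) (shaped⇒hBlock (xs n)))) ,
    blocks⇒isConcat (αBlock k) (λ _ → s≤s z≤n)
      (λ n → moveTo (αBlock k n) {y} (sym (length-αUpTo n)) (shaped⇒αBlock (ys n)))
    where
    z : Word (Fin (suc k))
    z n = HShaped.letter (xs n)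

-- (3) The automaton

-- In sync, block n of x is read against block n of y; in shifted,
-- block n of x against block n+1 of y; afterLetter and shifting are the
-- intermediate states entering these alignments; accept is the sink.
State : Set
State = Fin 6

pattern start       = zero
pattern sync        = suc zero
pattern afterLetter = suc (suc zero)
pattern accept      = suc (suc (suc zero))
pattern shifting    = suc (suc (suc (suc zero)))
pattern shifted     = suc (suc (suc (suc (suc zero))))

module Automaton (k : ℕ) where

  E : Set
  E = Ext k

  -- Transitions, named by what they read; σ ranges over Σ, suc τ over Σ ∖ {0}.
  data Code : Set where
    startSync syncZero afterLetterA      : Code
    syncLetter                           : Fin (suc k) → Code
    startShift shiftZero shiftedA        : Code
    shiftedLetter                        : Fin (suc k) → Code
    errShiftA errSyncA                   : Code
    errStartX errStartY errAfterLetter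
      errShiftedY errShiftedX            : Fin (suc k) → Code
    errSyncY errSyncX                    : Fin k → Code
    loop                                 : E → E → Code

  edge : Code → State × List E × List E × State
  edge startSync          = start       , [ A ]            , [ A ]            , sync
  edge syncZero           = sync        , [ 𝟎 ]            , [ 𝟎 ]            , sync
  edge (syncLetter σ)     = sync        , [ just σ ]       , [ A ]            , afterLetter
  edge afterLetterA       = afterLetter , [ A ]            , []               , sync
  edge startShift         = start       , []               , [ A ]            , shifting
  edge shiftZero          = shifting    , []               , [ 𝟎 ]            , shifted
  edge shiftedA           = shifted     , [ A ]            , [ A ]            , shifted
  edge (shiftedLetter σ)  = shifted     , [ just σ ]       , [ 𝟎 ]            , shifted
  -- a defect is a letter that the current alignment forbids on one tape
  edge (errStartX σ)      = start       , [ just σ ]       , []               , accept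
  edge (errStartY σ)      = start       , []               , [ just σ ]       , accept
  edge errSyncA           = sync        , [ A ]            , []               , accept
  edge (errSyncY τ)       = sync        , []               , [ just (suc τ) ] , accept
  edge (errSyncX τ)       = sync        , [ just (suc τ) ] , [ 𝟎 ]            , accept
  edge (errAfterLetter σ) = afterLetter , [ just σ ]       , []               , accept
  edge errShiftA          = shifting    , []               , [ A ]            , accept
  edge (errShiftedY σ)    = shifted     , [ A ]            , [ just σ ]       , accept
  edge (errShiftedX σ)    = shifted     , [ just σ ]       , [ A ]            , accept
  edge (loop a b)         = accept      , [ a ]            , [ b ]            , accept

  letters : List E
  letters = A ∷ map just (allFin (suc k))

  codesFor : Fin (suc k) → List Code
  codesFor σ = syncLetter σ ∷ shiftedLetter σ ∷ errStartX σ ∷ errStartY σ ∷ errAfterLetter σ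
             ∷ errShiftedY σ ∷ errShiftedX σ ∷ []

  codesForNonzero : Fin k → List Code
  codesForNonzero τ = errSyncY τ ∷ errSyncX τ ∷ []

  parametrised : List Code
  parametrised = concatMap codesFor (allFin (suc k))
              ++ concatMap codesForNonzero (allFin k) ++ cartesianProductWith loop letters letters

  allCodes : List Code
  allCodes = startSync ∷ syncZero ∷ afterLetterA ∷ startShift ∷ shiftZero ∷ shiftedA ∷ errShiftA ∷ errSyncA
           ∷ parametrised

  letter∈letters : (a : E) → a ∈ₗ letters
  letter∈letters A        = here refl
  letter∈letters (just σ) = there (∈-map⁺ just (∈-allFin σ))

  inParametrised : ∀ {c} → c ∈ₗ parametrised → c ∈ₗ allCodes
  inParametrised = there ∘ there ∘ there ∘ there ∘ there ∘ there ∘ there ∘ there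

  forLetter : ∀ {c} σ → c ∈ₗ codesFor σ → c ∈ₗ allCodes
  forLetter σ c∈ = inParametrised (∈-++⁺ˡ (∈-concatMap⁺ codesFor (lose (∈-allFin σ) c∈)))

  forNonzero : ∀ {c} τ → c ∈ₗ codesForNonzero τ → c ∈ₗ allCodes
  forNonzero τ c∈ = inParametrised (∈-++⁺ʳ (concatMap codesFor (allFin (suc k)))
                                     (∈-++⁺ˡ (∈-concatMap⁺ codesForNonzero (lose (∈-allFin τ) c∈))))

  code∈allCodes : (c : Code) → c ∈ₗ allCodes
  code∈allCodes startSync          = here refl
  code∈allCodes syncZero           = there (here refl)
  code∈allCodes afterLetterA       = there (there (here refl))
  code∈allCodes startShift         = there (there (there (here refl)))
  code∈allCodes shiftZero          = there (there (there (there (here refl))))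
  code∈allCodes shiftedA           = there (there (there (there (there (here refl)))))
  code∈allCodes errShiftA          = there (there (there (there (there (there (here refl))))))
  code∈allCodes errSyncA           = there (there (there (there (there (there (there (here refl)))))))
  code∈allCodes (syncLetter σ)     = forLetter σ (here refl)
  code∈allCodes (shiftedLetter σ)  = forLetter σ (there (here refl))
  code∈allCodes (errStartX σ)      = forLetter σ (there (there (here refl)))
  code∈allCodes (errStartY σ)      = forLetter σ (there (there (there (here refl))))
  code∈allCodes (errAfterLetter σ) = forLetter σ (there (there (there (there (here refl)))))
  code∈allCodes (errShiftedY σ)    = forLetter σ (there (there (there (there (there (here refl))))))
  code∈allCodes (errShiftedX σ)    = forLetter σ (there (there (there (there (there (there (here refl)))))))
  code∈allCodes (errSyncY τ)       = forNonzero τ (here refl)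
  code∈allCodes (errSyncX τ)       = forNonzero τ (there (here refl))
  code∈allCodes (loop a b)         = inParametrised
    (∈-++⁺ʳ (concatMap codesFor (allFin (suc k))) (∈-++⁺ʳ (concatMap codesForNonzero (allFin k))
      (∈-cartesianProductWith⁺ loop (letter∈letters a) (letter∈letters b))))

  Aut : TwoTapeBuchi E E
  Aut = record { nStates = 6 ; Δ = map edge allCodes ; q₀ = start ; F = ⁅ accept ⁆ }

  from to : Code → State
  from c = src Aut (edge c)
  to   c = tgt Aut (edge c)

  input output : Code → List E
  input  c = inLbl Aut (edge c)
  output c = outLbl Aut (edge c)

  -- (4) Finite paths into the sink are accepting runs

  data Path : State → Word E → Word E → Set where
    arrived : ∀ {w v} → Path accept w v
    via     : ∀ {w v} (c : Code) → Prefix (input c) w → Prefix (output c) v →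
              Path (to c) (suffix (length (input c)) w) (suffix (length (output c)) v) →
              Path (from c) w v

  Path-resp : ∀ {p w w′ v v′} → (∀ i → w i ≡ w′ i) → (∀ i → v i ≡ v′ i) → Path p w v → Path p w′ v′
  Path-resp eqw eqv arrived         = arrived
  Path-resp eqw eqv (via c pw pv π) =
    via c (Prefix-resp (input c) eqw pw) (Prefix-resp (output c) eqv pv)
          (Path-resp (eqw ∘ (_+ length (input c))) (eqv ∘ (_+ length (output c))) π)

  run : ∀ {p w v} → Path p w v → ℕ → Code
  run {w = w} {v} arrived       i       = loop (w i) (v i)
  run             (via c _ _ π) zero    = c
  run             (via c _ _ π) (suc i) = run π i

  run-starts : ∀ {p w v} (π : Path p w v) → from (run π 0) ≡ p
  run-starts arrived       = refl
  run-starts (via c _ _ π) = refl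

  run-linked : ∀ {p w v} (π : Path p w v) i → to (run π i) ≡ from (run π (suc i))
  run-linked arrived       i       = refl
  run-linked (via c _ _ π) zero    = sym (run-starts π)
  run-linked (via c _ _ π) (suc i) = run-linked π i

  run-successful : ∀ {p w v} (π : Path p w v) N → ∃ λ i → N ≤ i × to (run π i) ∈ ⁅ accept ⁆
  run-successful arrived       N = N , ≤-refl , x∈⁅x⁆ accept
  run-successful (via c _ _ π) N with run-successful π N
  ... | i , N≤i , final = suc i , m≤n⇒m≤1+n N≤i , final

  run-input : ∀ {p w v} (π : Path p w v) → IsConcat (λ i → input (run π i)) w
  run-input {w = w} arrived         = isConcat-letters w
  run-input         (via c pw pv π) = isConcat-cons (λ i → input (run (via c pw pv π) i)) pw (run-input π)

  run-output : ∀ {p w v} (π : Path p w v) → IsConcat (λ i → output (run π i)) v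
  run-output {v = v} arrived         = isConcat-letters v
  run-output         (via c pw pv π) = isConcat-cons (λ i → output (run (via c pw pv π) i)) pv (run-output π)

  path⇒accepts : ∀ {w v} → Path start w v → Accepts Aut w v
  path⇒accepts π = edge ∘ run π
                 , ((λ i → ∈-map⁺ edge (code∈allCodes (run π i))) , run-starts π , run-linked π)
                 , run-successful π , run-input π , run-output π

-- (5) Soundness: pairs of h(Σ^ω) × {α} are rejected

module Soundness (k : ℕ) {x y : Word (Ext k)}
                 (xs : ∀ n → Blocks.HShaped k x n) (ys : ∀ n → Blocks.αShaped k y n) where
  open Blocks k
  open Automaton k

  -- The configurations the automaton can be in on such a pair: in sync it is
  -- r+1 letters into block n of both tapes, in shifted r letters into block n
  -- of x and block n+1 of y.  The sink is missing.
  data Inv : State → ℕ → ℕ → Set where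
    atStart    : Inv start 0 0
    inSync     : ∀ n r → r ≤ suc n → Inv sync (suc r + hPos n) (suc r + αPos n)
    inAfter    : ∀ m → Inv afterLetter (hPos (suc m)) (suc (αPos (suc m)))
    atShifting : Inv shifting 0 1
    inShifted  : ∀ n r → r < 3 + n → Inv shifted (r + hPos n) (r + αPos (suc n))

  readX : ∀ {P a} → Prefix [ a ] (suffix P x) → x P ≡ a
  readX = read {w = x}

  readY : ∀ {P b} → Prefix [ b ] (suffix P y) → y P ≡ b
  readY = read {w = y}

  A≢letter : ∀ {a : E} {σ} → a ≡ A → a ≡ just σ → ⊥
  A≢letter refl ()

  zero≢nonzero : ∀ {a : E} {τ} → a ≡ 𝟎 → a ≡ just (suc τ) → ⊥
  zero≢nonzero refl ()

  yAfterMarker : ∀ n r → r ≤ suc n →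
                 (r ≤ n × y (suc r + αPos n) ≡ 𝟎) ⊎ (r ≡ suc n × y (suc r + αPos n) ≡ A)
  yAfterMarker n r r≤1+n with m≤n⇒m<n∨m≡n r≤1+n
  ... | inj₁ r<1+n = inj₁ (≤-pred r<1+n , αShaped.zeros (ys n) r (≤-pred r<1+n))
  ... | inj₂ refl  = inj₂ (refl , αShaped.marker (ys (suc n)))

  xInΣ : ∀ n r → r ≤ suc n → ∃ λ σ → x (suc r + hPos n) ≡ just σ
  xInΣ n = HShaped.inΣ (xs n)

  -- For the
  -- transitions of the two alignments this is position arithmetic; an error
  -- transition would read a letter that a well-shaped block excludes.
  preserved : ∀ {P Q} c → Inv (from c) P Q → Prefix (input c) (suffix P x) → Prefix (output c) (suffix Q y) →
              Inv (to c) (length (input c) + P) (length (output c) + Q)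
  preserved startSync atStart _ _ = inSync 0 0 z≤n
  preserved syncZero (inSync n r r≤1+n) _ py with yAfterMarker n r r≤1+n
  ... | inj₁ (r≤n , _) = inSync n (suc r) (s≤s r≤n)
  ... | inj₂ (_ , isA) = ⊥-elim (A≢letter isA (readY py))
  preserved (syncLetter σ) (inSync n r r≤1+n) _ py with yAfterMarker n r r≤1+n
  ... | inj₁ (_ , is0)  = ⊥-elim (A≢letter (readY py) is0)
  ... | inj₂ (refl , _) = inAfter n
  preserved afterLetterA (inAfter m) _ _ = inSync (suc m) 0 z≤n
  preserved startShift atStart _ _ = atShifting
  preserved shiftZero atShifting _ _ = inShifted 0 0 (s≤s z≤n)
  preserved shiftedA (inShifted n zero _) _ _ = inShifted n 1 (s≤s (s≤s z≤n))
  preserved shiftedA (inShifted n (suc r) r<3+n) px _ =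
    ⊥-elim (A≢letter (readX px) (proj₂ (xInΣ n r (≤-pred (≤-pred r<3+n)))))
  preserved (shiftedLetter σ) (inShifted n zero _) px _ = ⊥-elim (A≢letter (HShaped.marker (xs n)) (readX px))
  preserved (shiftedLetter σ) (inShifted n (suc r) r<3+n) _ _ with m≤n⇒m<n∨m≡n (≤-pred (≤-pred r<3+n))
  ... | inj₁ r<1+n = inShifted n (suc (suc r)) (s≤s (s≤s r<1+n))
  ... | inj₂ refl  = inShifted (suc n) 0 (s≤s z≤n)
  preserved errShiftA atShifting _ py = ⊥-elim (A≢letter (readY py) (αShaped.zeros (ys 0) 0 z≤n))
  preserved errSyncA (inSync n r r≤1+n) px _ = ⊥-elim (A≢letter (readX px) (proj₂ (xInΣ n r r≤1+n)))
  preserved (errStartX σ) atStart px _ = ⊥-elim (A≢letter (HShaped.marker (xs 0)) (readX px))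
  preserved (errStartY σ) atStart _ py = ⊥-elim (A≢letter (αShaped.marker (ys 0)) (readY py))
  preserved (errAfterLetter σ) (inAfter m) px _ = ⊥-elim (A≢letter (HShaped.marker (xs (suc m))) (readX px))
  preserved (errShiftedY σ) (inShifted n zero _) _ py = ⊥-elim (A≢letter (αShaped.marker (ys (suc n))) (readY py))
  preserved (errShiftedY σ) (inShifted n (suc r) r<3+n) px _ =
    ⊥-elim (A≢letter (readX px) (proj₂ (xInΣ n r (≤-pred (≤-pred r<3+n)))))
  preserved (errShiftedX σ) (inShifted n zero _) px _ = ⊥-elim (A≢letter (HShaped.marker (xs n)) (readX px))
  preserved (errShiftedX σ) (inShifted n (suc r) r<3+n) _ py =
    ⊥-elim (A≢letter (readY py) (αShaped.zeros (ys (suc n)) r (≤-pred (≤-pred r<3+n))))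
  preserved (errSyncY τ) (inSync n r r≤1+n) _ py with yAfterMarker n r r≤1+n
  ... | inj₁ (_ , is0) = ⊥-elim (zero≢nonzero is0 (readY py))
  ... | inj₂ (_ , isA) = ⊥-elim (A≢letter isA (readY py))
  preserved (errSyncX τ) (inSync n r r≤1+n) px py with yAfterMarker n r r≤1+n
  ... | inj₁ (r≤n , _) = ⊥-elim (zero≢nonzero (HShaped.zeros (xs n) r r≤n) (readX px))
  ... | inj₂ (_ , isA) = ⊥-elim (A≢letter isA (readY py))
  preserved (loop a b) () _ _

  sound : ¬ Accepts Aut x y
  sound = invariant⇒rejects Aut x y Inv atStart step notAtSink
    where
    step : ∀ {P Q} t → t ∈ₗ map edge allCodes → Inv (src Aut t) P Q →
           Prefix (inLbl Aut t) (suffix P x) → Prefix (outLbl Aut t) (suffix Q y) →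
           Inv (tgt Aut t) (length (inLbl Aut t) + P) (length (outLbl Aut t) + Q)
    step t t∈Δ with ∈-map⁻ edge {xs = allCodes} t∈Δ
    ... | c , _ , refl = preserved c
    notAtSink : ∀ {q P Q} → q ∈ ⁅ accept ⁆ → ¬ Inv q P Q
    notAtSink q∈F = subst (λ q → ¬ Inv q _ _) (sym (x∈⁅y⁆⇒x≡y accept q∈F)) (λ ())

-- (6) Completeness: pairs outside h(Σ^ω) × {α} are accepted

module Completeness (k : ℕ) (x y : Word (Ext k)) where
  open Blocks k
  open Automaton k

  data Reach : State → ℕ → ℕ → Set where
    initial : Reach start 0 0
    step    : ∀ {P Q} (c : Code) → Reach (from c) P Q →
              Prefix (input c) (suffix P x) → Prefix (output c) (suffix Q y) →
              Reach (to c) (length (input c) + P) (length (output c) + Q)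

  reach⇒path : ∀ {p P Q} → Reach p P Q → Path p (suffix P x) (suffix Q y) → Path start x y
  reach⇒path initial π = Path-resp (suffix-zero x) (suffix-zero y) π
  reach⇒path (step {P} {Q} c r px py) π =
    reach⇒path r (via c px py (Path-resp (suffix-+ (length (input c)) P x)
                                         (suffix-+ (length (output c)) Q y) π))

  sinkReached : ∀ {P Q} → Reach accept P Q → Accepts Aut x y
  sinkReached r = path⇒accepts (reach⇒path r arrived)

  atX : ∀ {P a} → x P ≡ a → Prefix [ a ] (suffix P x)
  atX = written {w = x}

  atY : ∀ {P b} → y P ≡ b → Prefix [ b ] (suffix P y)
  atY = written {w = y}

  Good Below : ℕ → Set
  Good n  = HShaped x n × αShaped y n
  Below n = ∀ i → i < n → Good i

  earlier : ∀ {m} → Below (suc m) → Below m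
  earlier below i i<m = below i (m≤n⇒m≤1+n i<m)

  latest : ∀ {m} → Below (suc m) → Good m
  latest below = below _ ≤-refl

  reachSync  : ∀ n → Below n → x (hPos n) ≡ A → y (αPos n) ≡ A → Reach sync (suc (hPos n)) (suc (αPos n))
  reachAfter : ∀ m → Below (suc m) → y (αPos (suc m)) ≡ A → Reach afterLetter (hPos (suc m)) (suc (αPos (suc m)))

  syncZeros : ∀ n r → Reach sync (suc (hPos n)) (suc (αPos n)) →
              (∀ r′ → r′ < r → x (suc r′ + hPos n) ≡ 𝟎 × y (suc r′ + αPos n) ≡ 𝟎) →
              Reach sync (suc r + hPos n) (suc r + αPos n)
  syncZeros n zero    reach _     = reach
  syncZeros n (suc r) reach zeros =
    step syncZero (syncZeros n r reach (λ r′ r′<r → zeros r′ (m≤n⇒m≤1+n r′<r)))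
         (atX (proj₁ (zeros r ≤-refl))) (atY (proj₂ (zeros r ≤-refl)))

  reachSync zero    _     xa ya = step startSync initial (atX xa) (atY ya)
  reachSync (suc m) below xa ya = step afterLetterA (reachAfter m below ya) (atX xa) tt

  reachAfter m below ya with latest below
  ... | hs , as = step (syncLetter (HShaped.letter hs))
                       (syncZeros m (suc m) (reachSync m (earlier below) (HShaped.marker hs) (αShaped.marker as))
                         (λ r r<1+m → HShaped.zeros hs r (≤-pred r<1+m) , αShaped.zeros as r (≤-pred r<1+m)))
                       (atX (HShaped.letterAt hs)) (atY ya)

  ShiftedOK : ℕ → ℕ → Set
  ShiftedOK m zero    = x (hPos m) ≡ A × y (αPos (suc m)) ≡ A
  ShiftedOK m (suc r) = (∃ λ σ → x (suc r + hPos m) ≡ just σ) × y (suc r + αPos (suc m)) ≡ 𝟎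

  shiftedScan : ∀ m r → Reach shifted (hPos m) (αPos (suc m)) → (∀ r′ → r′ < r → ShiftedOK m r′) →
                Reach shifted (r + hPos m) (r + αPos (suc m))
  shiftedScan m zero    reach _  = reach
  shiftedScan m (suc r) reach ok =
    advance r (shiftedScan m r reach (λ r′ r′<r → ok r′ (m≤n⇒m≤1+n r′<r))) (ok r ≤-refl)
    where
    advance : ∀ r → Reach shifted (r + hPos m) (r + αPos (suc m)) → ShiftedOK m r →
              Reach shifted (suc r + hPos m) (suc r + αPos (suc m))
    advance zero    reach (xa , ya)       = step shiftedA reach (atX xa) (atY ya)
    advance (suc r) reach ((σ , xσ) , y0) = step (shiftedLetter σ) reach (atX xσ) (atY y0)

  reachShifted : ∀ m → Below m → αShaped y m → Reach shifted (hPos m) (αPos (suc m))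
  reachShifted zero    _     as = step shiftZero (step startShift initial tt (atY (αShaped.marker as))) tt
                                      (atY (αShaped.zeros as 0 z≤n))
  reachShifted (suc m) below as with latest below
  ... | hs , as′ = shiftedScan m (3 + m) (reachShifted m (earlier below) as′) ok
    where
    ok : ∀ r → r < 3 + m → ShiftedOK m r
    ok zero    _     = HShaped.marker hs , αShaped.marker as
    ok (suc r) r<2+m = HShaped.inΣ hs r (≤-pred (≤-pred r<2+m)) , αShaped.zeros as r (≤-pred (≤-pred r<2+m))

  yLetterAtMarker : ∀ n {σ} → Below n → y (αPos n) ≡ just σ → Accepts Aut x y
  yLetterAtMarker zero    _     yσ = sinkReached (step (errStartY _) initial tt (atY yσ))
  yLetterAtMarker (suc m) below yσ with latest below
  ... | hs , as = sinkReached (step (errShiftedY _) (reachShifted m (earlier below) as)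
                                   (atX (HShaped.marker hs)) (atY yσ))

  xLetterAtMarker : ∀ n {σ} → Below n → y (αPos n) ≡ A → x (hPos n) ≡ just σ → Accepts Aut x y
  xLetterAtMarker zero    _     _  xσ = sinkReached (step (errStartX _) initial (atX xσ) tt)
  xLetterAtMarker (suc m) below ya xσ = sinkReached (step (errAfterLetter _) (reachAfter m below ya) (atX xσ) tt)

  -- a zero run of y that ends after only r+1 < n+2 zeros, seen by the shifted alignment.
  yRunTooShort : ∀ n r → r ≤ n → Below n → y (αPos n) ≡ A → (∀ r′ → r′ < r → y (suc r′ + αPos n) ≡ 𝟎) →
                 y (suc r + αPos n) ≡ A → Accepts Aut x y
  yRunTooShort zero zero _ _ ya _ yA =
    sinkReached (step errShiftA (step startShift initial tt (atY ya)) tt (atY yA))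
  yRunTooShort (suc m) r r≤1+m below ya zeros yA with latest below
  ... | hs , as with HShaped.inΣ hs r r≤1+m
  ...   | σ , xσ = sinkReached (step (errShiftedX σ)
                                     (shiftedScan m (suc r) (reachShifted m (earlier below) as) ok)
                                     (atX xσ) (atY yA))
    where
    ok : ∀ r′ → r′ < suc r → ShiftedOK m r′
    ok zero     _    = HShaped.marker hs , ya
    ok (suc r′) r′<r = HShaped.inΣ hs r′ (≤-trans (<⇒≤ (≤-pred r′<r)) r≤1+m) , zeros r′ (≤-pred r′<r)

  module InBlock (n : ℕ) (below : Below n) (xa : x (hPos n) ≡ A) (ya : y (αPos n) ≡ A) where

    Zeros : ℕ → Set
    Zeros r = ∀ r′ → r′ < r → x (suc r′ + hPos n) ≡ 𝟎 × y (suc r′ + αPos n) ≡ 𝟎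

    compareAt : ∀ r → r ≤ n → Zeros r → Reach sync (suc r + hPos n) (suc r + αPos n) →
                ∀ a → x (suc r + hPos n) ≡ a → ∀ b → y (suc r + αPos n) ≡ b →
                Accepts Aut x y ⊎ (Zeros (suc r) × Reach sync (suc (suc r) + hPos n) (suc (suc r) + αPos n))
    compareAt r r≤n zeros reach _ _ A yA =
      inj₁ (yRunTooShort n r r≤n below ya (λ r′ r′<r → proj₂ (zeros r′ r′<r)) yA)
    compareAt r _ _ reach _ _ (just (suc τ)) yτ =
      inj₁ (sinkReached (step (errSyncY τ) reach tt (atY yτ)))
    compareAt r _ _ reach A xA 𝟎 _ =
      inj₁ (sinkReached (step errSyncA reach (atX xA) tt))
    compareAt r _ _ reach (just (suc τ)) xτ 𝟎 y0 =
      inj₁ (sinkReached (step (errSyncX τ) reach (atX xτ) (atY y0)))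
    compareAt r _ zeros reach 𝟎 x0 𝟎 y0 =
      inj₂ (extendBelow zeros (x0 , y0) , step syncZero reach (atX x0) (atY y0))

    zeroScan : ∀ r → r ≤ suc n → Accepts Aut x y ⊎ (Zeros r × Reach sync (suc r + hPos n) (suc r + αPos n))
    zeroScan zero    _       = inj₂ ((λ _ ()) , reachSync n below xa ya)
    zeroScan (suc r) r<1+n with zeroScan r (<⇒≤ r<1+n)
    ... | inj₁ acc             = inj₁ acc
    ... | inj₂ (zeros , reach) =
      compareAt r (≤-pred r<1+n) zeros reach (x (suc r + hPos n)) refl (y (suc r + αPos n)) refl

    afterZeros : Accepts Aut x y ⊎ Good n
    afterZeros with zeroScan (suc n) ≤-refl
    ... | inj₁ acc = inj₁ acc
    ... | inj₂ (zeros , reach) with x (suc (suc n) + hPos n) in xℓ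
    ...   | A      = inj₁ (sinkReached (step errSyncA reach (atX xℓ) tt))
    ...   | just σ = inj₂ ( record { marker = xa ; zeros = λ r r≤n → proj₁ (zeros r (s≤s r≤n))
                                   ; letter = σ ; letterAt = xℓ }
                          , record { marker = ya ; zeros = λ r r≤n → proj₂ (zeros r (s≤s r≤n)) } )

  blockScan : ∀ n → Below n → Accepts Aut x y ⊎ Good n
  blockScan n below with y (αPos n) in ya | x (hPos n) in xa
  ... | just σ | _      = inj₁ (yLetterAtMarker n below ya)
  ... | A      | just σ = inj₁ (xLetterAtMarker n below ya xa)
  ... | A      | A      = InBlock.afterZeros n below xa ya

  -- Excluded middle decides whether the pair is accepted; if it is not, every
  -- scan ends with a well-formed block, so the pair lies in h(Σ^ω) × {α}.
  complete : ExcludedMiddle 0ℓ → ¬ InHα k x y → Accepts Aut x y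
  complete em notInHα with em {Accepts Aut x y}
  ... | yes accepted = accepted
  ... | no rejected  = ⊥-elim (notInHα (shaped⇒InHα (proj₁ ∘ good) (proj₂ ∘ good)))
    where
    goodBelow : ∀ n → Below n
    goodBelow zero    _ ()
    goodBelow (suc n) =
      extendBelow (goodBelow n) ([ ⊥-elim ∘ rejected , id ]′ (blockScan n (goodBelow n)))
    good : ∀ n → Good n
    good n = goodBelow (suc n) n ≤-refl

lemma8 : ExcludedMiddle 0ℓ → (k : ℕ) → IsInfinitaryRational (R₂ k)
lemma8 em k = Automaton.Aut k , λ x y → mk⇔
  (λ accepted inHα → let (xs , ys) = Blocks.InHα⇒shaped k inHα in Soundness.sound k xs ys accepted)
  (Completeness.complete k x y em)
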